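{- Let $n \geq 3$ be an integer with $n \neq 7$. Then $n$ and $n+2$ are both prime (i.e. they are twin primes) if and only if the integer $4(n-3)! + 2 + n$ is divisible by $n$ but not divisible by $n+2$. The equivalence fails for $n = 7$: there $4(n-3)!+2+n$ is divisible by $n$ but not by $n+2$, yet $n+2$ is not prime. -}

module Defs where

-- Wilson's theorem, proved by pairing each of 2, …, p − 2 with its (distinct) inverse modulo p,
-- gives (p − 2)! ≡ 1, hence 2 (p − 3)! ≡ −1 and p ∣ 4 (p − 3)! + 2 + p for every prime p.
-- Conversely, a composite c = a b with 1 < a ≤ b divides (c − k)! as soon as b and, when a = b,
-- also 2a fit below c − k; this holds for k = 3 when c ≥ 8 and for k = 5 when c ≥ 10.
-- So a composite n divides 4 (n − 3)! + 2 + n only if it divides 2, and a composite n + 2 ≥ 10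
-- always divides it, while a prime n + 2 divides neither 4 nor (n − 3)!.
-- The exception n = 7 is n + 2 = 3², whose factors 3 and 6 do not both fit in 4!.

module Submission where

open import Defs
open import Data.Nat using (ℕ; _+_; _*_; _∸_; _≤_; _!)
open import Data.Nat.Divisibility using (_∣_)
open import Data.Nat.Primality using (Prime)
open import Data.Product using (_×_)
open import Function.Bundles using (_⇔_)
open import Relation.Nullary using (¬_)
open import Relation.Binary.PropositionalEquality using (_≢_)

open import Data.Empty using (⊥-elim)
open import Data.List.Base using (List; []; _∷_; length; applyDownFrom)
open import Data.List.Membership.Propositional using (_∈_)
open import Data.List.Membership.Propositional.Properties
  using (∈-∃++; ∈-applyDownFrom⁺; ∈-applyDownFrom⁻)
open import Data.List.Relation.Binary.Permutation.Propositional
  using (_↭_; prep; ↭-sym; ↭⇒↭ₛ)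
open import Data.List.Relation.Binary.Permutation.Propositional.Properties
  using (shift; ∈-resp-↭; ↭-length)
open import Data.List.Relation.Binary.Permutation.Setoid.Properties using (Unique-resp-↭)
open import Data.List.Relation.Unary.All using (lookup)
open import Data.List.Relation.Unary.AllPairs using (_∷_)
open import Data.List.Relation.Unary.Any using (here; there)
open import Data.List.Relation.Unary.Unique.Propositional using (Unique)
open import Data.List.Relation.Unary.Unique.Propositional.Properties using (applyDownFrom⁺₁)
open import Data.Nat.Base
open import Data.Nat.Coprimality using (coprime-Bézout; prime⇒coprime)
import Data.Nat.Coprimality as Coprime
open import Data.Nat.DivMod
open import Data.Nat.Divisibility
open import Data.Nat.GCD using (module Bézout)
open import Data.Nat.ListAction using (product)
open import Data.Nat.ListAction.Properties using (product-↭)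
open import Data.Nat.Primality
  using (Composite; composite; composite?; prime?; ¬prime⇒composite; ¬prime[0]; ¬prime[1];
         prime⇒nonZero; prime⇒nonTrivial; euclidsLemma)
open import Data.Nat.Properties
open import Data.Nat.Tactic.RingSolver using (solve-∀)
open import Data.Product using (∃-syntax; _,_)
open import Data.Sum using (_⊎_; inj₁; inj₂)
open import Function.Bundles using (mk⇔)
open import Relation.Nullary.Decidable using (from-yes; from-no; decidable-stable)
open import Relation.Binary.PropositionalEquality

∈⇒↭∷ : ∀ {y : ℕ} {xs} → y ∈ xs → ∃[ ys ] xs ↭ y ∷ ys
∈⇒↭∷ {y} y∈xs with as , bs , refl ← ∈-∃++ y∈xs = _ , shift y as bs

m∣n∧n<m⇒n≡0 : ∀ {m n} → m ∣ n → n < m → n ≡ 0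
m∣n∧n<m⇒n≡0 {n = zero}  _   _   = refl
m∣n∧n<m⇒n≡0 {n = suc _} m∣n n<m = ⊥-elim (>⇒∤ n<m m∣n)

%≡%⇒∣∸ : ∀ {m u v} .{{_ : NonZero m}} → u % m ≡ v % m → u ≤ v → m ∣ v ∸ u
%≡%⇒∣∸ {m} {u} {v} eq u≤v = divides (v / m ∸ u / m) (begin
  v ∸ u                                     ≡⟨ cong₂ _∸_ (m≡m%n+[m/n]*n v m) (m≡m%n+[m/n]*n u m) ⟩
  (v % m + v / m * m) ∸ (u % m + u / m * m) ≡⟨ cong (λ r → (r + v / m * m) ∸ (u % m + u / m * m)) eq ⟨
  (u % m + v / m * m) ∸ (u % m + u / m * m) ≡⟨ [m+n]∸[m+o]≡n∸o (u % m) _ _ ⟩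
  v / m * m ∸ u / m * m                     ≡⟨ *-distribʳ-∸ m (v / m) (u / m) ⟨
  (v / m ∸ u / m) * m                       ∎)
  where open ≡-Reasoning

m*[n%o]%o≡m*n%o : ∀ m n o .{{_ : NonZero o}} → m * (n % o) % o ≡ m * n % o
m*[n%o]%o≡m*n%o m n o = begin
  m * (n % o) % o             ≡⟨ %-distribˡ-* m (n % o) o ⟩
  (m % o) * (n % o % o) % o   ≡⟨ cong (λ r → (m % o) * r % o) (m%n%n≡m%n n o) ⟩
  (m % o) * (n % o) % o       ≡⟨ %-distribˡ-* m n o ⟨
  m * n % o                   ∎
  where open ≡-Reasoning

m%[1+n]≡1⇒1+n∣n*m+1 : ∀ m n → m % suc n ≡ 1 → suc n ∣ n * m + 1
m%[1+n]≡1⇒1+n∣n*m+1 m n m%[1+n]≡1 = divides (1 + n * q) (begin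
  n * m + 1                       ≡⟨ cong (λ r → n * r + 1) (m≡m%n+[m/n]*n m (suc n)) ⟩
  n * (m % suc n + q * suc n) + 1 ≡⟨ cong (λ r → n * (r + q * suc n) + 1) m%[1+n]≡1 ⟩
  n * (1 + q * suc n) + 1         ≡⟨ identity n q ⟩
  (1 + n * q) * suc n             ∎)
  where
  open ≡-Reasoning
  q = m / suc n
  identity : ∀ n q → n * (1 + q * suc n) + 1 ≡ (1 + n * q) * suc n
  identity = solve-∀

module _ (m : ℕ) .{{_ : NonTrivial m}} where

  private instance
    m≢0 : NonZero m
    m≢0 = nonTrivial⇒nonZero m

  1%m≡1 : 1 % m ≡ 1
  1%m≡1 = m<n⇒m%n≡m (nonTrivial⇒n>1 m)

  inverse-sym : ∀ x y → x * y % m ≡ 1 → y * x % m ≡ 1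
  inverse-sym x y = trans (cong (_% m) (*-comm y x))

  *-pres-%≡1 : ∀ {x y} → x % m ≡ 1 → y % m ≡ 1 → x * y % m ≡ 1
  *-pres-%≡1 {x} {y} x≡1 y≡1 = begin
    x * y % m               ≡⟨ %-distribˡ-* x y m ⟩
    (x % m) * (y % m) % m   ≡⟨ cong₂ (λ a b → a * b % m) x≡1 y≡1 ⟩
    1 % m                   ≡⟨ 1%m≡1 ⟩
    1                       ∎
    where open ≡-Reasoning

  record Paired (xs : List ℕ) : Set where
    field
      unique         : Unique xs
      inverse        : ∀ {x} → x ∈ xs → ∃[ y ] y ∈ xs × y ≢ x × x * y % m ≡ 1
      inverse-unique : ∀ x {y z} → y ∈ xs → z ∈ xs → x * y % m ≡ 1 → x * z % m ≡ 1 → y ≡ z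

  Paired-resp-↭ : ∀ {xs ys} → xs ↭ ys → Paired xs → Paired ys
  Paired-resp-↭ σ P = record
    { unique         = Unique-resp-↭ (setoid ℕ) (↭⇒↭ₛ σ) unique
    ; inverse        = λ x∈ys → let y , y∈xs , rest = inverse (∈-resp-↭ (↭-sym σ) x∈ys)
                                in y , ∈-resp-↭ σ y∈xs , rest
    ; inverse-unique = λ x y∈ys z∈ys →
                         inverse-unique x (∈-resp-↭ (↭-sym σ) y∈ys) (∈-resp-↭ (↭-sym σ) z∈ys)
    }
    where open Paired P

  Paired-drop-pair : ∀ {x y ys} → Paired (x ∷ y ∷ ys) → x * y % m ≡ 1 → Paired ys
  Paired-drop-pair {x} {y} {ys} P xy≡1 with Paired.unique P
  ... | x≢ ∷ y≢ ∷ ys-unique = record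
    { unique         = ys-unique
    ; inverse        = inverse′
    ; inverse-unique = λ u y∈ys z∈ys → inverse-unique u (there (there y∈ys)) (there (there z∈ys))
    }
    where
    open Paired P
    inverse′ : ∀ {z} → z ∈ ys → ∃[ w ] w ∈ ys × w ≢ z × z * w % m ≡ 1
    inverse′ {z} z∈ys with inverse (there (there z∈ys))
    ... | _ , here refl , _ , zx≡1 = ⊥-elim (lookup y≢ z∈ys (sym
          (inverse-unique x (there (there z∈ys)) (there (here refl)) (inverse-sym z x zx≡1) xy≡1)))
    ... | _ , there (here refl) , _ , zy≡1 = ⊥-elim (lookup x≢ (there z∈ys) (sym
          (inverse-unique y (there (there z∈ys)) (here refl)
            (inverse-sym z y zy≡1) (inverse-sym x y xy≡1))))
    ... | w , there (there w∈ys) , w≢z , zw≡1 = w , w∈ys , w≢z , zw≡1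

  product-paired≡1 : ∀ xs → Paired xs → product xs % m ≡ 1
  product-paired≡1 xs = go (length xs) xs ≤-refl
    where
    go : ∀ n xs → length xs ≤ n → Paired xs → product xs % m ≡ 1
    go _       []       _          _ = 1%m≡1
    go (suc n) (x ∷ xs) (s≤s |xs|≤n) P with Paired.inverse P (here refl)
    ... | _ , here refl , y≢x , _  = ⊥-elim (y≢x refl)
    ... | y , there y∈xs , _ , xy≡1 with ys , σ ← ∈⇒↭∷ y∈xs = begin
      product (x ∷ xs) % m          ≡⟨ cong (_% m) (product-↭ (prep x σ)) ⟩
      x * (y * product ys) % m      ≡⟨ cong (_% m) (*-assoc x y _) ⟨
      x * y * product ys % m        ≡⟨ *-pres-%≡1 xy≡1 (go n ys |ys|≤n P′) ⟩
      1                             ∎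
      where
      open ≡-Reasoning
      |ys|≤n : length ys ≤ n
      |ys|≤n = ≤-trans (n≤1+n _) (subst (_≤ n) (↭-length σ) |xs|≤n)
      P′ : Paired ys
      P′ = Paired-drop-pair (Paired-resp-↭ (prep x σ) P) xy≡1

module _ {p : ℕ} (p-prime : Prime p) where

  private instance
    p≢0 : NonZero p
    p≢0 = prime⇒nonZero p-prime
    p>1 : NonTrivial p
    p>1 = prime⇒nonTrivial p-prime

  inverse⇒∤ : ∀ x {y} → x * y % p ≡ 1 → ¬ p ∣ x
  inverse⇒∤ x {y} xy≡1 p∣x = 0≢1+n (trans (sym (n∣m⇒m%n≡0 (x * y) p (∣m⇒∣m*n y p∣x))) xy≡1)

  *-cancelˡ-%≡-≤ : ∀ x {y z} → ¬ p ∣ x → x * y % p ≡ x * z % p → y ≤ z → z < p → y ≡ z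
  *-cancelˡ-%≡-≤ x {y} {z} p∤x eq y≤z z<p
    with euclidsLemma x (z ∸ y) p-prime
           (subst (p ∣_) (sym (*-distribˡ-∸ x z y)) (%≡%⇒∣∸ eq (*-monoʳ-≤ x y≤z)))
  ... | inj₁ p∣x   = ⊥-elim (p∤x p∣x)
  ... | inj₂ p∣z∸y = ≤-antisym y≤z (m∸n≡0⇒m≤n (m∣n∧n<m⇒n≡0 p∣z∸y (≤-<-trans (m∸n≤m z y) z<p)))

  *-cancelˡ-%≡ : ∀ x {y z} → ¬ p ∣ x → x * y % p ≡ x * z % p → y < p → z < p → y ≡ z
  *-cancelˡ-%≡ x {y} {z} p∤x eq y<p z<p with ≤-total y z
  ... | inj₁ y≤z = *-cancelˡ-%≡-≤ x p∤x eq y≤z z<p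
  ... | inj₂ z≤y = sym (*-cancelˡ-%≡-≤ x p∤x (sym eq) z≤y y<p)

  inverse-unique : ∀ x {y z} → x * y % p ≡ 1 → x * z % p ≡ 1 → y < p → z < p → y ≡ z
  inverse-unique x xy≡1 xz≡1 = *-cancelˡ-%≡ x (inverse⇒∤ x xy≡1) (trans xy≡1 (sym xz≡1))

  ∣1+t⇒t*t%p≡1 : ∀ {t} → p ∣ suc t → t * t % p ≡ 1
  ∣1+t⇒t*t%p≡1 {t} (divides k 1+t≡kp) = begin
    t * t % p                  ≡⟨ %-remove-+ʳ (t * t) {d = p} (∣n⇒∣m*n 2 (n∣m*n k)) ⟨
    (t * t + 2 * (k * p)) % p  ≡⟨ cong (_% p) square-identity ⟩
    (1 + k * p * (k * p)) % p  ≡⟨ %-remove-+ʳ 1 {d = p} (∣n⇒∣m*n (k * p) (n∣m*n k)) ⟩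
    1 % p                      ≡⟨ 1%m≡1 p ⟩
    1                          ∎
    where
    open ≡-Reasoning
    identity : ∀ t → t * t + 2 * suc t ≡ 1 + suc t * suc t
    identity = solve-∀
    square-identity : t * t + 2 * (k * p) ≡ 1 + k * p * (k * p)
    square-identity rewrite sym 1+t≡kp = identity t

  t*t%p≡1⇒t≡±1 : ∀ {t} → t < p → t * t % p ≡ 1 → t ≡ 1 ⊎ suc t ≡ p
  t*t%p≡1⇒t≡±1 {zero}  _     0≡1   = ⊥-elim (0≢1+n (trans (sym (m*n%n≡0 0 p)) 0≡1))
  t*t%p≡1⇒t≡±1 {suc k} 1+k<p t²≡1
    with euclidsLemma (2 + k) k p-prime
           (subst (p ∣_) (identity k) (%≡%⇒∣∸ (trans (1%m≡1 p) (sym t²≡1)) (s≤s z≤n)))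
    where
    identity : ∀ k → k + k * suc k ≡ (2 + k) * k
    identity = solve-∀
  ... | inj₁ p∣2+k = inj₂ (≤-antisym 1+k<p (∣⇒≤ p∣2+k))
  ... | inj₂ p∣k   = inj₁ (cong suc (m∣n∧n<m⇒n≡0 p∣k (<-trans (n<1+n k) 1+k<p)))

  inverse-exists : ∀ {x} → 0 < x → x < p → ∃[ y ] x * y % p ≡ 1
  inverse-exists {x@(suc _)} _ x<p with coprime-Bézout (Coprime.sym (prime⇒coprime p-prime x<p))
  ... | Bézout.+- a b 1+bp≡ax = a , (begin
    x * a % p        ≡⟨ cong (_% p) (trans (*-comm x a) (sym 1+bp≡ax)) ⟩
    (1 + b * p) % p  ≡⟨ [m+kn]%n≡m%n 1 b p ⟩
    1 % p            ≡⟨ 1%m≡1 p ⟩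
    1                ∎)
    where open ≡-Reasoning
  ... | Bézout.-+ a b 1+ax≡bp =
    -- a x ≡ -1, so (a x)² ≡ 1
    a * (a * x) , trans (cong (_% p) (identity x a)) (∣1+t⇒t*t%p≡1 (divides b 1+ax≡bp))
    where identity : ∀ x a → x * (a * (a * x)) ≡ a * x * (a * x)
          identity = solve-∀

  reduced-inverse-exists : ∀ {x} → 0 < x → x < p → ∃[ y ] y < p × x * y % p ≡ 1
  reduced-inverse-exists {x} 0<x x<p with y , xy≡1 ← inverse-exists 0<x x<p =
    y % p , m%n<n y p , trans (m*[n%o]%o≡m*n%o x y p) xy≡1

  inverse-in-range : ∀ {x y} → 2 ≤ x → suc x < p → y < p → x * y % p ≡ 1 →
                     2 ≤ y × suc y < p × y ≢ x
  inverse-in-range {x} {zero} _ _ _ x0≡1 =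
    ⊥-elim (0≢1+n (trans (sym (m*n%n≡0 0 p)) (trans (cong (_% p) (sym (*-zeroʳ x))) x0≡1)))
  inverse-in-range {x} {1} 2≤x 1+x<p _ x1≡1 = ⊥-elim (<⇒≢ 2≤x (sym (begin
    x          ≡⟨ m<n⇒m%n≡m (<-trans (n<1+n x) 1+x<p) ⟨
    x % p      ≡⟨ cong (_% p) (*-identityʳ x) ⟨
    x * 1 % p  ≡⟨ x1≡1 ⟩
    1          ∎)))
    where open ≡-Reasoning
  inverse-in-range {x} {y@(suc (suc _))} 2≤x 1+x<p y<p xy≡1 = s≤s (s≤s z≤n) , 1+y<p , y≢x
    where
    x<p = <-trans (n<1+n x) 1+x<p
    y≢x : y ≢ x
    y≢x y≡x with t*t%p≡1⇒t≡±1 x<p (subst (λ z → x * z % p ≡ 1) y≡x xy≡1)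
    ... | inj₁ x≡1   = <⇒≢ 2≤x (sym x≡1)
    ... | inj₂ 1+x≡p = <⇒≢ 1+x<p 1+x≡p
    1+y<p : suc y < p
    1+y<p = ≤∧≢⇒< y<p λ 1+y≡p → y≢x (inverse-unique y
      (∣1+t⇒t*t%p≡1 (subst (p ∣_) (sym 1+y≡p) ∣-refl)) (inverse-sym p x y xy≡1) y<p x<p)

product-applyDownFrom-2+ : ∀ k → product (applyDownFrom (2 +_) k) ≡ (1 + k) !
product-applyDownFrom-2+ zero    = refl
product-applyDownFrom-2+ (suc k) = cong ((2 + k) *_) (product-applyDownFrom-2+ k)

applyDownFrom-2+-paired : ∀ {k} → Prime (3 + k) → Paired (3 + k) (applyDownFrom (2 +_) k)
applyDownFrom-2+-paired {k} p-prime = record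
  { unique         = applyDownFrom⁺₁ (2 +_) k
                       (λ j<i _ 2+i≡2+j → <⇒≢ j<i (sym (+-cancelˡ-≡ 2 _ _ 2+i≡2+j)))
  ; inverse        = inverse
  ; inverse-unique = λ x y∈ z∈ xy≡1 xz≡1 → inverse-unique p-prime x xy≡1 xz≡1 (∈⇒<p y∈) (∈⇒<p z∈)
  }
  where
  L = applyDownFrom (2 +_) k
  ∈⇒<p : ∀ {x} → x ∈ L → x < 3 + k
  ∈⇒<p x∈L with i , i<k , refl ← ∈-applyDownFrom⁻ (2 +_) x∈L = s≤s (s≤s (m<n⇒m<1+n i<k))
  inverse : ∀ {x} → x ∈ L → ∃[ y ] y ∈ L × y ≢ x × x * y % (3 + k) ≡ 1
  inverse x∈L with i , i<k , refl ← ∈-applyDownFrom⁻ (2 +_) x∈L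
    with y , y<p , xy≡1 ← reduced-inverse-exists p-prime (s≤s z≤n) (s≤s (s≤s (m<n⇒m<1+n i<k)))
    with inverse-in-range p-prime (s≤s (s≤s z≤n)) (s≤s (s≤s (s≤s i<k))) y<p xy≡1
  ... | s≤s (s≤s z≤n) , s≤s (s≤s (s≤s j<k)) , y≢x = y , ∈-applyDownFrom⁺ (2 +_) j<k , y≢x , xy≡1

wilson : ∀ {p} → Prime p → p ∣ (p ∸ 1) ! + 1
wilson {0} p-prime = ⊥-elim (¬prime[0] p-prime)
wilson {1} p-prime = ⊥-elim (¬prime[1] p-prime)
wilson {2} _       = ∣-refl
wilson {suc (suc (suc k))} p-prime = m%[1+n]≡1⇒1+n∣n*m+1 ((1 + k) !) (2 + k)
  (subst (λ r → r % (3 + k) ≡ 1) (product-applyDownFrom-2+ k)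
    (product-paired≡1 (3 + k) _ (applyDownFrom-2+-paired p-prime)))

0<m≤n⇒m∣n! : ∀ {m n} → 0 < m → m ≤ n → m ∣ n !
0<m≤n⇒m∣n! {suc m} _ m≤n = ∣-trans (m∣m*n (m !)) (m≤n⇒m!∣n! m≤n)

0<m<n≤o⇒m*n∣o! : ∀ {m n o} → 0 < m → m < n → n ≤ o → m * n ∣ o !
0<m<n≤o⇒m*n∣o! {m} {suc n} {o} 0<m (s≤s m≤n) n≤o = begin
  m * suc n      ≡⟨ *-comm m (suc n) ⟩
  suc n * m      ∣⟨ *-monoʳ-∣ (suc n) (0<m≤n⇒m∣n! 0<m m≤n) ⟩
  suc n * n !    ∣⟨ m≤n⇒m!∣n! n≤o ⟩
  o !            ∎
  where open ∣-Reasoning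

0<n⇒n*n∣[2n]! : ∀ {n} → 0 < n → n * n ∣ (2 * n) !
0<n⇒n*n∣[2n]! {n} 0<n =
  ∣-trans (*-monoʳ-∣ n (n∣m*n 2)) (0<m<n≤o⇒m*n∣o! 0<n n<2n ≤-refl)
  where n<2n : n < 2 * n
        n<2n = subst (n <_) (cong (n +_) (sym (+-identityʳ n))) (m<m+n n 0<n)

2m≤o∧2n≤o⇒m+n≤o : ∀ {m n o} → 2 * m ≤ o → 2 * n ≤ o → m + n ≤ o
2m≤o∧2n≤o⇒m+n≤o {m} {n} {o} 2m≤o 2n≤o = *-cancelˡ-≤ 2 (begin
  2 * (m + n)    ≡⟨ *-distribˡ-+ 2 m n ⟩
  2 * m + 2 * n  ≤⟨ +-mono-≤ 2m≤o 2n≤o ⟩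
  o + o          ≡⟨ cong (o +_) (+-identityʳ o) ⟨
  2 * o          ∎)
  where open ≤-Reasoning

composite⇒ordered-factors : ∀ {n} → Composite n → ∃[ a ] ∃[ b ] 1 < a × a ≤ b × n ≡ a * b
composite⇒ordered-factors (composite {d} d<n d∣n@(divides q n≡qd)) with ≤-total d q
... | inj₁ d≤q = d , q , nonTrivial⇒n>1 d , d≤q , trans n≡qd (*-comm q d)
... | inj₂ q≤d = q , d , quotient>1 d∣n d<n , q≤d , n≡qd

composite⇒∣[n∸k]! : ∀ {n} k → Composite n → 2 * k ≤ n → (∀ d → d * d ≡ n → 2 * d + k ≤ n) →
                    n ∣ (n ∸ k) !
composite⇒∣[n∸k]! k c 2k≤n squares with composite⇒ordered-factors c
... | a , b , 1<a , a≤b , refl with m≤n⇒m<n∨m≡n a≤b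
...   | inj₁ a<b  = 0<m<n≤o⇒m*n∣o! (<-trans z<s 1<a) a<b
                      (m+n≤o⇒m≤o∸n b (2m≤o∧2n≤o⇒m+n≤o {b} {k} (*-monoˡ-≤ b 1<a) 2k≤n))
...   | inj₂ refl = ∣-trans (0<n⇒n*n∣[2n]! (<-trans z<s 1<a))
                      (m≤n⇒m!∣n! (m+n≤o⇒m≤o∸n (2 * a) (squares a refl)))

prime∣n!⇒≤ : ∀ {p} n → Prime p → p ∣ n ! → p ≤ n
prime∣n!⇒≤ zero    p-prime p∣1  = ⊥-elim (nonTrivial⇒≢1 {{prime⇒nonTrivial p-prime}} (∣1⇒≡1 p∣1))
prime∣n!⇒≤ (suc n) p-prime p∣n! with euclidsLemma (suc n) (n !) p-prime p∣n!
... | inj₁ p∣1+n = ∣⇒≤ p∣1+n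
... | inj₂ p∣n!′ = m≤n⇒m≤1+n (prime∣n!⇒≤ n p-prime p∣n!′)

twinTest : ℕ → ℕ
twinTest n = 4 * (n ∸ 3) ! + 2 + n

prime⇒∣twinTest : ∀ {n} → Prime n → n ∣ twinTest n
prime⇒∣twinTest {0} n-prime = ⊥-elim (¬prime[0] n-prime)
prime⇒∣twinTest {1} n-prime = ⊥-elim (¬prime[1] n-prime)
prime⇒∣twinTest {2} _       = from-yes (2 ∣? twinTest 2)
prime⇒∣twinTest {n@(suc (suc (suc m)))} n-prime =
  subst (n ∣_) (sym (test-identity m (m !))) (∣m∣n⇒∣m+n (∣n⇒∣m*n 2 n∣2m!+1) ∣-refl)
  where
  wilson-identity : ∀ m F → (2 + m) * ((1 + m) * F) + 1 ≡ (3 + m) * (m * F) + (2 * F + 1)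
  wilson-identity = solve-∀
  test-identity : ∀ m F → 4 * F + 2 + (3 + m) ≡ 2 * (2 * F + 1) + (3 + m)
  test-identity = solve-∀
  n∣2m!+1 : n ∣ 2 * m ! + 1
  n∣2m!+1 = ∣m+n∣m⇒∣n (subst (n ∣_) (wilson-identity m (m !)) (wilson n-prime)) (m∣m*n (m * m !))

d*d≡8+r⇒2d+3≤8+r : ∀ {r} d → d * d ≡ 8 + r → 2 * d + 3 ≤ 8 + r
d*d≡8+r⇒2d+3≤8+r d@(suc (suc (suc t))) d*d≡8+r =
  subst (2 * d + 3 ≤_) (trans (identity t) d*d≡8+r) (m≤m+n (2 * d + 3) (4 * t + t * t))
  where identity : ∀ t → 2 * (3 + t) + 3 + (4 * t + t * t) ≡ (3 + t) * (3 + t)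
        identity = solve-∀

d*d≡10+r⇒2d+5≤10+r : ∀ {r} d → d * d ≡ 10 + r → 2 * d + 5 ≤ 10 + r
d*d≡10+r⇒2d+5≤10+r d@(suc (suc (suc (suc t)))) d*d≡10+r =
  subst (2 * d + 5 ≤_) (trans (identity t) d*d≡10+r) (m≤m+n (2 * d + 5) (3 + 6 * t + t * t))
  where identity : ∀ t → 2 * (4 + t) + 5 + (3 + 6 * t + t * t) ≡ (4 + t) * (4 + t)
        identity = solve-∀

composite⇒∤twinTest : ∀ {n} → Composite n → ¬ n ∣ twinTest n
composite⇒∤twinTest {0} c = ⊥-elim (from-no (composite? 0) c)
composite⇒∤twinTest {1} c = ⊥-elim (from-no (composite? 1) c)
composite⇒∤twinTest {2} c = ⊥-elim (from-no (composite? 2) c)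
composite⇒∤twinTest {3} c = ⊥-elim (from-no (composite? 3) c)
composite⇒∤twinTest {4} _ = from-no (4 ∣? twinTest 4)
composite⇒∤twinTest {5} c = ⊥-elim (from-no (composite? 5) c)
composite⇒∤twinTest {6} _ = from-no (6 ∣? twinTest 6)
composite⇒∤twinTest {7} c = ⊥-elim (from-no (composite? 7) c)
composite⇒∤twinTest {n@(suc (suc (suc (suc (suc (suc (suc (suc r))))))))} n-composite n∣test =
  >⇒∤ (s≤s (s≤s (s≤s z≤n))) (∣m+n∣m⇒∣n n∣4F+2 (∣n⇒∣m*n 4 n∣F))
  where
  F = (5 + r) !
  n∣F : n ∣ F
  n∣F = composite⇒∣[n∸k]! 3 n-composite (m≤m+n 6 (2 + r)) d*d≡8+r⇒2d+3≤8+r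
  n∣4F+2 : n ∣ 4 * F + 2
  n∣4F+2 = ∣m+n∣m⇒∣n (subst (n ∣_) (+-comm (4 * F + 2) n) n∣test) ∣-refl

prime[n+2]⇒∤twinTest : ∀ {n} → 3 ≤ n → Prime (n + 2) → ¬ n + 2 ∣ twinTest n
prime[n+2]⇒∤twinTest {1} (s≤s ())
prime[n+2]⇒∤twinTest {2} (s≤s (s≤s ()))
prime[n+2]⇒∤twinTest {n@(suc (suc (suc m)))} 3≤n p-prime p∣test
  with euclidsLemma 4 (m !) p-prime (∣m+n∣m⇒∣n (subst (p ∣_) (identity m (m !)) p∣test) ∣-refl)
  where
  p = n + 2
  identity : ∀ m F → 4 * F + 2 + (3 + m) ≡ 3 + m + 2 + 4 * F
  identity = solve-∀
... | inj₁ p∣4  = >⇒∤ (+-monoˡ-≤ 2 3≤n) p∣4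
... | inj₂ p∣m! = <⇒≱ (≤-trans (m≤n+m (suc m) 2) (m≤m+n n 2)) (prime∣n!⇒≤ m p-prime p∣m!)

composite[n+2]⇒∣twinTest : ∀ {n} → Prime n → n ≢ 7 → Composite (n + 2) → n + 2 ∣ twinTest n
composite[n+2]⇒∣twinTest {0} n-prime = ⊥-elim (¬prime[0] n-prime)
composite[n+2]⇒∣twinTest {1} n-prime = ⊥-elim (¬prime[1] n-prime)
composite[n+2]⇒∣twinTest {2} _ _ _ = from-yes (4 ∣? twinTest 2)
composite[n+2]⇒∣twinTest {3} _ _ c = ⊥-elim (from-no (composite? 5) c)
composite[n+2]⇒∣twinTest {4} n-prime _ _ = ⊥-elim (from-no (prime? 4) n-prime)
composite[n+2]⇒∣twinTest {5} _ _ c = ⊥-elim (from-no (composite? 7) c)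
composite[n+2]⇒∣twinTest {6} _ _ _ = from-yes (8 ∣? twinTest 6)
composite[n+2]⇒∣twinTest {7} _ n≢7 _ = ⊥-elim (n≢7 refl)
composite[n+2]⇒∣twinTest {n@(suc (suc (suc (suc (suc (suc (suc (suc r))))))))} _ _ c =
  subst₂ _∣_ (sym n+2≡10+r) (sym (identity r F)) (∣m∣n⇒∣m+n (∣n⇒∣m*n 4 10+r∣F) ∣-refl)
  where
  F = (5 + r) !
  n+2≡10+r : n + 2 ≡ 10 + r
  n+2≡10+r = cong (8 +_) (+-comm r 2)
  10+r∣F : 10 + r ∣ F
  10+r∣F = composite⇒∣[n∸k]! 5 (subst Composite n+2≡10+r c) (m≤m+n 10 r) d*d≡10+r⇒2d+5≤10+r
  identity : ∀ r F → 4 * F + 2 + (8 + r) ≡ 4 * F + (10 + r)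
  identity = solve-∀

twinTest⇒twin-primes : ∀ {n} → 3 ≤ n → n ≢ 7 → n ∣ twinTest n → ¬ n + 2 ∣ twinTest n →
                       Prime n × Prime (n + 2)
twinTest⇒twin-primes {n} 3≤n n≢7 n∣test n+2∤test = n-prime , n+2-prime
  where
  n-prime : Prime n
  n-prime = decidable-stable (prime? n) λ n-not-prime →
    composite⇒∤twinTest
      (¬prime⇒composite {{n>1⇒nonTrivial (≤-trans (n≤1+n 2) 3≤n)}} n-not-prime) n∣test
  n+2-prime : Prime (n + 2)
  n+2-prime = decidable-stable (prime? (n + 2)) λ n+2-not-prime →
    n+2∤test (composite[n+2]⇒∣twinTest n-prime n≢7
      (¬prime⇒composite {{n>1⇒nonTrivial (m≤n+m 2 n)}} n+2-not-prime))

theorem2 : ((n : ℕ) → 3 ≤ n → n ≢ 7 →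
               ((Prime n × Prime (n + 2)) ⇔
                ((n ∣ 4 * (n ∸ 3) ! + 2 + n) × ¬ (n + 2 ∣ 4 * (n ∸ 3) ! + 2 + n))))
             × ((7 ∣ 4 * (7 ∸ 3) ! + 2 + 7) × ¬ (7 + 2 ∣ 4 * (7 ∸ 3) ! + 2 + 7) × ¬ Prime (7 + 2))
theorem2 =
  (λ n 3≤n n≢7 → mk⇔
    (λ (n-prime , n+2-prime) → prime⇒∣twinTest n-prime , prime[n+2]⇒∤twinTest 3≤n n+2-prime)
    (λ (n∣test , n+2∤test) → twinTest⇒twin-primes 3≤n n≢7 n∣test n+2∤test)) ,
  (from-yes (7 ∣? twinTest 7) , from-no (9 ∣? twinTest 7) , from-no (prime? 9))
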